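{- Let $k$ be a number field and let $f,g\colon\mathbb{P}^N\dashrightarrow\mathbb{P}^N$ be dominant rational self-maps over $k$ whose restrictions to $\mathbb{A}^N$ are morphisms of the form $f=(f_1,\dots,f_N)$, $g=(g_1,\dots,g_N)$ with $f_i,g_i\in k[x_i,\dots,x_N]$, each satisfying that either $\deg_{x_i}(\cdot)_i>\deg_{x_{i+1}}(\cdot)_{i+1}$ for all $i=1,\dots,N-1$ or $N=2$. Let $\mathrm{Deg}(f)=(d_{i,j})$ with $d_{i,j}=\deg_{x_i}f_j$ and $\mathrm{Deg}(g)=(d'_{i,j})$ with $d'_{i,j}=\deg_{x_i}g_j$, and let $\mathrm{Deg}(f\circ g)$ be the analogous $N\times N$ matrix for $f\circ g$. Then, entrywise, $$\mathrm{diag}(d_{1,1}d'_{1,1},\dots,d_{N,N}d'_{N,N})\le\mathrm{Deg}(f\circ g)\le\mathrm{Deg}(g)\,\mathrm{Deg}(f).$$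
   Context: For real matrices $A=(a_{i,j}),B=(b_{i,j})$, $A\le B$ means $a_{i,j}\le b_{i,j}$ for all $i,j$. The $(i,j)$ entry of $\mathrm{Deg}(f\circ g)$ is $\deg_{x_i}(f\circ g)_j$, where $(f\circ g)|_{\mathbb{A}^N}=((f\circ g)_1,\dots,(f\circ g)_N)$. -}

module Defs where

open import Level using (0ℓ)
open import Algebra.Bundles using (CommutativeRing)
open import Data.Nat using (ℕ; zero; suc; _⊔_; _<_; _≤_) renaming (_+_ to _+ℕ_; _*_ to _*ℕ_)
open import Data.Integer using (ℤ; +_; -[1+_])
open import Data.Fin using (Fin; zero; suc; toℕ)
open import Data.Fin.Properties using () renaming (_≟_ to _≟F_)
open import Data.List using (List; []; _∷_; map)
open import Data.Bool using (Bool; true; false; _∧_; if_then_else_)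
open import Data.Product using (Σ; ∃; ∃₂; _×_; _,_)
open import Data.Sum using (_⊎_)
open import Function using (_∘_)
open import Relation.Nullary using (¬_; does)
open import Relation.Binary using (Decidable)
open import Relation.Binary.PropositionalEquality using (_≡_)

module _ (R : CommutativeRing 0ℓ 0ℓ) where
  open CommutativeRing R using (Carrier; _≈_; _+_; _*_; -_; 0#; 1#)

  fromℕ : ℕ → Carrier
  fromℕ zero    = 0#
  fromℕ (suc n) = 1# + fromℕ n

  fromℤ : ℤ → Carrier
  fromℤ (+ n)      = fromℕ n
  fromℤ -[1+ n ]   = - fromℕ (suc n)

  sumR : ∀ {n} → (Fin n → Carrier) → Carrier
  sumR {zero}  v = 0#
  sumR {suc n} v = v zero + sumR (v ∘ suc)

  -- R is a number field: a field of characteristic 0 which is finite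
  -- dimensional over its prime field ℚ (spanned over ℚ by finitely many
  -- elements e₁,…,eₙ).
  record IsNumberField : Set where
    field
      1≉0       : ¬ (1# ≈ 0#)
      inverse   : ∀ x → ¬ (x ≈ 0#) → Σ Carrier (λ y → x * y ≈ 1#)
      char0     : ∀ n → ¬ (fromℕ (suc n) ≈ 0#)
      finiteDim : Σ ℕ λ n → Σ (Fin n → Carrier) λ e →
                    ∀ x → Σ ℕ λ b → Σ (Fin n → ℤ) λ a →
                      fromℕ (suc b) * x ≈ sumR (λ i → fromℤ (a i) * e i)

-- Polynomials in n variables x₁,…,xₙ over R (dense recursive form):
-- Poly (suc n) = polynomials in x₁ (list of coefficients, lowest degree
-- first) whose coefficients are polynomials in x₂,…,x_{n+1}.

  data Poly : ℕ → Set where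
    con  : Carrier → Poly zero
    poly : ∀ {n} → List (Poly n) → Poly (suc n)

  𝟘 : ∀ {n} → Poly n
  𝟘 {zero}  = con 0#
  𝟘 {suc n} = poly []

  const : ∀ {n} → Carrier → Poly n
  const {zero}  c = con c
  const {suc n} c = poly (const c ∷ [])

  infixl 6 _⊕_ _⊕L_
  infixl 7 _⊛_ _⊛L_

  mutual
    _⊕_ : ∀ {n} → Poly n → Poly n → Poly n
    con a  ⊕ con b  = con (a + b)
    poly p ⊕ poly q = poly (p ⊕L q)

    _⊕L_ : ∀ {n} → List (Poly n) → List (Poly n) → List (Poly n)
    []      ⊕L q       = q
    (a ∷ p) ⊕L []      = a ∷ p
    (a ∷ p) ⊕L (b ∷ q) = (a ⊕ b) ∷ (p ⊕L q)

  mutual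
    _⊛_ : ∀ {n} → Poly n → Poly n → Poly n
    con a  ⊛ con b  = con (a * b)
    poly p ⊛ poly q = poly (p ⊛L q)

    _⊛L_ : ∀ {n} → List (Poly n) → List (Poly n) → List (Poly n)
    []      ⊛L q = []
    (a ∷ p) ⊛L q = scale a q ⊕L (𝟘 ∷ (p ⊛L q))

    scale : ∀ {n} → Poly n → List (Poly n) → List (Poly n)
    scale a []      = []
    scale a (b ∷ q) = (a ⊛ b) ∷ scale a q

  -- the variable x_{i+1} (i : Fin n zero-based)
  var : ∀ {n} → Fin n → Poly n
  var {suc n} zero    = poly (𝟘 ∷ const 1# ∷ [])
  var {suc n} (suc i) = poly (var i ∷ [])

  mutual
    subst : ∀ {m n} → Poly m → (Fin m → Poly n) → Poly n
    subst (con c)  σ = const c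
    subst (poly p) σ = substL p σ

    substL : ∀ {m n} → List (Poly m) → (Fin (suc m) → Poly n) → Poly n
    substL []       σ = 𝟘
    substL (c ∷ cs) σ = subst c (σ ∘ suc) ⊕ (σ zero ⊛ substL cs σ)

  PolyMap : ℕ → Set
  PolyMap N = Fin N → Poly N

  _∘ₚ_ : ∀ {N} → PolyMap N → PolyMap N → PolyMap N
  (f ∘ₚ g) j = subst (f j) g

module _ (R : CommutativeRing 0ℓ 0ℓ)
         (_≟_ : Decidable (CommutativeRing._≈_ R)) where
  open CommutativeRing R using (Carrier; _≈_; _+_; _*_; -_; 0#; 1#)

  mutual
    isZero : ∀ {n} → Poly R n → Bool
    isZero (con c)  = does (c ≟ 0#)
    isZero (poly p) = isZeroL p

    isZeroL : ∀ {n} → List (Poly R n) → Bool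
    isZeroL []       = true
    isZeroL (c ∷ cs) = isZero c ∧ isZeroL cs

  maxℕ : List ℕ → ℕ
  maxℕ []       = 0
  maxℕ (x ∷ xs) = x ⊔ maxℕ xs

  -- degree of a list of coefficients (lowest first) in its variable
  -- (convention: deg 0 = 0)
  degL : ∀ {n} → List (Poly R n) → ℕ
  degL []       = 0
  degL (c ∷ cs) = if isZeroL cs then 0 else suc (degL cs)

  -- deg_{x_{i+1}} p  (i : Fin n zero-based; deg of the zero polynomial = 0)
  degVar : ∀ {n} → Fin n → Poly R n → ℕ
  degVar zero    (poly p) = degL p
  degVar (suc i) (poly p) = maxℕ (map (degVar i) p)

  Deg : ∀ {N} → PolyMap R N → Fin N → Fin N → ℕ
  Deg f i j = degVar i (f j)

  Triangular : ∀ {N} → PolyMap R N → Set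
  Triangular f = ∀ i j → toℕ j < toℕ i → degVar j (f i) ≡ 0

  DegCondition : ∀ {N} → PolyMap R N → Set
  DegCondition {N} f =
    (∀ (i j : Fin N) → toℕ j ≡ suc (toℕ i) → degVar j (f j) < degVar i (f i))
    ⊎ N ≡ 2

  -- dominance of f : 𝔸ᴺ → 𝔸ᴺ : the comorphism k[y₁..y_N] → k[x₁..x_N],
  -- P ↦ P(f₁,…,f_N), is injective (f₁,…,f_N algebraically independent)
  Dominant : ∀ {N} → PolyMap R N → Set
  Dominant {N} f = ∀ (P : Poly R N) → isZero (subst R P f) ≡ true → isZero P ≡ true

Mat : ℕ → Set
Mat N = Fin N → Fin N → ℕ

sumℕ : ∀ {n} → (Fin n → ℕ) → ℕ
sumℕ {zero}  v = 0
sumℕ {suc n} v = v zero +ℕ sumℕ (v ∘ suc)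

_·ₘ_ : ∀ {N} → Mat N → Mat N → Mat N
(A ·ₘ B) i j = sumℕ (λ k → A i k *ℕ B k j)

_≤ₘ_ : ∀ {N} → Mat N → Mat N → Set
A ≤ₘ B = ∀ i j → A i j ≤ B i j

diag : ∀ {N} → (Fin N → ℕ) → Mat N
diag v i j = if does (i ≟F j) then v i else 0

{-# OPTIONS --safe #-}
-- Upper bound: x_i-degrees are subadditive under ⊕ (max) and ⊛ (sum), so
-- evaluating f_j at g by Horner's scheme gives
-- deg_{x_i} f_j(g) ≤ Σ_k deg_{x_i} g_k · deg_{y_k} f_j, the (i,j) entry of Deg(g)·Deg(f).
--
-- Lower bound on the diagonal: f_i involves only y_i,…,y_N and g_i,…,g_N only
-- x_i,…,x_N, so discarding the first i-1 variables reduces to i = 1. Write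
-- f_1 = Σ_m c_m(y_2,…,y_N) y_1^m. Each c_m(g_2,…,g_N) is free of x_1, and nonzero when
-- c_m is, by dominance of g; over a domain the term c_m(g_2,…,g_N) g_1^m then has
-- x_1-degree exactly m · deg_{x_1} g_1, so the top term cannot cancel.
module Submission where

open import Defs
  hiding (Poly; _⊕_; _⊕L_; _⊛_; _⊛L_; scale; 𝟘; const; subst; substL; isZero; isZeroL; degL; degVar; maxℕ)
open import Level using (0ℓ)
open import Algebra.Bundles using (CommutativeRing)
open import Data.Nat using (ℕ) renaming (_*_ to _*ℕ_)
open import Data.Product using (_×_)
open import Relation.Binary using (Decidable)

open import Data.Nat using (zero; suc; _⊔_; _≤_; _<_; z≤n; s≤s) renaming (_+_ to _+ℕ_)
open import Data.Nat.Properties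
  using (≤-refl; ≤-trans; ≤-reflexive; m≤m⊔n; m≤n⊔m; ⊔-lub; ⊔-mono-≤; ⊔-identityʳ;
         +-mono-≤; +-monoʳ-≤; *-monoʳ-≤; m≤n+m; *-suc; *-zeroʳ; +-assoc; ≤-pred; n≮0; 0≢1+n;
         module ≤-Reasoning)
open import Data.Bool using (Bool; true; false; _∧_)
open import Data.Bool.Properties using (∧-zeroʳ; ∧-identityʳ; not-¬; ¬-not)
open import Data.Fin using (Fin; toℕ) renaming (zero to fz; suc to fs)
open import Data.Fin.Properties using () renaming (_≟_ to _≟F_)
open import Data.List using (List; []; _∷_; map)
open import Data.Product using (_,_; proj₁; proj₂)
open import Data.Sum using (_⊎_; inj₁; inj₂; [_,_]′)
open import Data.Empty using (⊥-elim)
open import Function using (_∘_; mk⇔)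
open import Relation.Nullary using (¬_; yes; no)
open import Relation.Nullary.Decidable using (dec-true; dec-false; does-⇔)
open import Relation.Binary.PropositionalEquality using (_≡_; refl; cong; cong₂; sym; trans)
import Relation.Binary.Reasoning.Setoid as SetoidReasoning

module _ (R : CommutativeRing 0ℓ 0ℓ) (_≟_ : Decidable (CommutativeRing._≈_ R)) where
  open CommutativeRing R using (_≈_; _*_; 0#; 1#; setoid; *-cong; *-comm; *-assoc; *-identityˡ; zeroʳ)
    renaming (refl to ≈-refl; sym to ≈-sym)
  open SetoidReasoning setoid

  numberField-noZeroDivisors : IsNumberField R → ∀ {x y} → x * y ≈ 0# → x ≈ 0# ⊎ y ≈ 0#
  numberField-noZeroDivisors nf {x} {y} xy≈0 with x ≟ 0#
  ... | yes x≈0 = inj₁ x≈0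
  ... | no  x≉0 = inj₂ (begin
    y            ≈⟨ ≈-sym (*-identityˡ y) ⟩
    1# * y       ≈⟨ *-cong (≈-sym xz≈1) ≈-refl ⟩
    (x * z) * y  ≈⟨ *-cong (*-comm x z) ≈-refl ⟩
    (z * x) * y  ≈⟨ *-assoc z x y ⟩
    z * (x * y)  ≈⟨ *-cong ≈-refl xy≈0 ⟩
    z * 0#       ≈⟨ zeroʳ z ⟩
    0#           ∎)
    where
      z = proj₁ (IsNumberField.inverse nf x x≉0)
      xz≈1 = proj₂ (IsNumberField.inverse nf x x≉0)

module Polynomials (R : CommutativeRing 0ℓ 0ℓ) (_≟_ : Decidable (CommutativeRing._≈_ R)) where
  open CommutativeRing R
    using (Carrier; _≈_; _*_; 0#; +-cong; +-identityˡ; +-identityʳ; *-cong; zeroˡ; zeroʳ)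
    renaming (refl to ≈-refl; sym to ≈-sym; trans to ≈-trans)

  Poly : ℕ → Set
  Poly = Defs.Poly R

  infixl 6 _⊕_ _⊕L_
  infixl 7 _⊛_ _⊛L_

  _⊕_ : ∀ {n} → Poly n → Poly n → Poly n
  _⊕_ = Defs._⊕_ R

  _⊕L_ : ∀ {n} → List (Poly n) → List (Poly n) → List (Poly n)
  _⊕L_ = Defs._⊕L_ R

  _⊛_ : ∀ {n} → Poly n → Poly n → Poly n
  _⊛_ = Defs._⊛_ R

  _⊛L_ : ∀ {n} → List (Poly n) → List (Poly n) → List (Poly n)
  _⊛L_ = Defs._⊛L_ R

  scale : ∀ {n} → Poly n → List (Poly n) → List (Poly n)
  scale = Defs.scale R

  𝟘 : ∀ {n} → Poly n
  𝟘 = Defs.𝟘 R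

  const : ∀ {n} → Carrier → Poly n
  const = Defs.const R

  subst : ∀ {m n} → Poly m → (Fin m → Poly n) → Poly n
  subst = Defs.subst R

  substL : ∀ {m n} → List (Poly m) → (Fin (suc m) → Poly n) → Poly n
  substL = Defs.substL R

  isZero : ∀ {n} → Poly n → Bool
  isZero = Defs.isZero R _≟_

  isZeroL : ∀ {n} → List (Poly n) → Bool
  isZeroL = Defs.isZeroL R _≟_

  degL : ∀ {n} → List (Poly n) → ℕ
  degL = Defs.degL R _≟_

  degVar : ∀ {n} → Fin n → Poly n → ℕ
  degVar = Defs.degVar R _≟_

  maxDeg : ∀ {n} → Fin n → List (Poly n) → ℕ
  maxDeg i p = Defs.maxℕ R _≟_ (map (degVar i) p)

  IsZero : ∀ {n} → Poly n → Set
  IsZero a = isZero a ≡ true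

  IsZeroL : ∀ {n} → List (Poly n) → Set
  IsZeroL p = isZeroL p ≡ true

  ∧-elimˡ : ∀ {x y} → x ∧ y ≡ true → x ≡ true
  ∧-elimˡ {true} _ = refl

  ∧-elimʳ : ∀ {x y} → x ∧ y ≡ true → y ≡ true
  ∧-elimʳ {true} e = e

  ∧-intro : ∀ {x y} → x ≡ true → y ≡ true → x ∧ y ≡ true
  ∧-intro refl refl = refl

  IsZero-con⁻ : ∀ {x} → IsZero (con x) → x ≈ 0#
  IsZero-con⁻ {x} z with x ≟ 0#
  ... | yes x≈0 = x≈0

  IsZero-con⁺ : ∀ {x} → x ≈ 0# → IsZero (con x)
  IsZero-con⁺ {x} = dec-true (x ≟ 0#)

  IsZero-𝟘 : ∀ {n} → IsZero (𝟘 {n})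
  IsZero-𝟘 {zero}  = IsZero-con⁺ ≈-refl
  IsZero-𝟘 {suc n} = refl

  IsZero-const : ∀ {n x} → x ≈ 0# → IsZero (const {n} x)
  IsZero-const {zero}  x≈0 = IsZero-con⁺ x≈0
  IsZero-const {suc n} x≈0 = ∧-intro (IsZero-const {n} x≈0) refl

  -- Equality of represented polynomials: coefficientwise up to ≈, ignoring
  -- trailing zero coefficients of the dense coefficient lists.
  infix 4 _≋_ _≋L_
  data _≋_ : ∀ {n} → Poly n → Poly n → Set
  data _≋L_ : ∀ {n} → List (Poly n) → List (Poly n) → Set

  data _≋_ where
    con≈  : ∀ {x y} → x ≈ y → con x ≋ con y
    poly≋ : ∀ {n} {p q : List (Poly n)} → p ≋L q → poly p ≋ poly q

  data _≋L_ where
    []≋ : ∀ {n} {q : List (Poly n)} → IsZeroL q → [] ≋L q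
    ≋[] : ∀ {n} {a} {p : List (Poly n)} → IsZeroL (a ∷ p) → a ∷ p ≋L []
    _∷_ : ∀ {n} {a b} {p q : List (Poly n)} → a ≋ b → p ≋L q → a ∷ p ≋L b ∷ q

  mutual
    ≋-refl : ∀ {n} {a : Poly n} → a ≋ a
    ≋-refl {a = con x}  = con≈ ≈-refl
    ≋-refl {a = poly p} = poly≋ ≋L-refl

    ≋L-refl : ∀ {n} {p : List (Poly n)} → p ≋L p
    ≋L-refl {p = []}    = []≋ refl
    ≋L-refl {p = a ∷ p} = ≋-refl ∷ ≋L-refl

  mutual
    ≋-sym : ∀ {n} {a b : Poly n} → a ≋ b → b ≋ a
    ≋-sym (con≈ e)  = con≈ (≈-sym e)
    ≋-sym (poly≋ e) = poly≋ (≋L-sym e)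

    ≋L-sym : ∀ {n} {p q : List (Poly n)} → p ≋L q → q ≋L p
    ≋L-sym {q = []}    ([]≋ z) = []≋ z
    ≋L-sym {q = _ ∷ _} ([]≋ z) = ≋[] z
    ≋L-sym (≋[] z)             = []≋ z
    ≋L-sym (e ∷ f)             = ≋-sym e ∷ ≋L-sym f

  IsZeroL⇒≋[] : ∀ {n} {q : List (Poly n)} → IsZeroL q → q ≋L []
  IsZeroL⇒≋[] z = ≋L-sym ([]≋ z)

  mutual
    isZero-resp-≋ : ∀ {n} {a b : Poly n} → a ≋ b → isZero a ≡ isZero b
    isZero-resp-≋ (con≈ e)  = does-⇔ (mk⇔ (≈-trans (≈-sym e)) (≈-trans e)) (_ ≟ 0#) (_ ≟ 0#)
    isZero-resp-≋ (poly≋ e) = isZeroL-resp-≋ e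

    isZeroL-resp-≋ : ∀ {n} {p q : List (Poly n)} → p ≋L q → isZeroL p ≡ isZeroL q
    isZeroL-resp-≋ ([]≋ z) = sym z
    isZeroL-resp-≋ (≋[] z) = z
    isZeroL-resp-≋ (e ∷ f) = cong₂ _∧_ (isZero-resp-≋ e) (isZeroL-resp-≋ f)

  IsZero-resp-≋ : ∀ {n} {a b : Poly n} → a ≋ b → IsZero a → IsZero b
  IsZero-resp-≋ e z = trans (sym (isZero-resp-≋ e)) z

  IsZeroL-resp-≋ : ∀ {n} {p q : List (Poly n)} → p ≋L q → IsZeroL p → IsZeroL q
  IsZeroL-resp-≋ e z = trans (sym (isZeroL-resp-≋ e)) z

  mutual
    zeros-≋ : ∀ {n} (a b : Poly n) → IsZero a → IsZero b → a ≋ b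
    zeros-≋ (con x)  (con y)  za zb = con≈ (≈-trans (IsZero-con⁻ za) (≈-sym (IsZero-con⁻ zb)))
    zeros-≋ (poly p) (poly q) za zb = poly≋ (zerosL-≋ p q za zb)

    zerosL-≋ : ∀ {n} (p q : List (Poly n)) → IsZeroL p → IsZeroL q → p ≋L q
    zerosL-≋ []      q       _  zq = []≋ zq
    zerosL-≋ (a ∷ p) []      zp _  = ≋[] zp
    zerosL-≋ (a ∷ p) (b ∷ q) zp zq =
      zeros-≋ a b (∧-elimˡ zp) (∧-elimˡ zq) ∷ zerosL-≋ p q (∧-elimʳ zp) (∧-elimʳ zq)

  mutual
    ≋-trans : ∀ {n} {a b c : Poly n} → a ≋ b → b ≋ c → a ≋ c
    ≋-trans (con≈ e)  (con≈ f)  = con≈ (≈-trans e f)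
    ≋-trans (poly≋ e) (poly≋ f) = poly≋ (≋L-trans e f)

    ≋L-trans : ∀ {n} {p q r : List (Poly n)} → p ≋L q → q ≋L r → p ≋L r
    ≋L-trans ([]≋ z) f = []≋ (IsZeroL-resp-≋ f z)
    ≋L-trans {r = []}    (≋[] z) ([]≋ _) = ≋[] z
    ≋L-trans {r = _ ∷ _} (≋[] z) ([]≋ y) = zerosL-≋ _ _ z y
    ≋L-trans {r = []}    (e ∷ f) (≋[] z) = ≋[] (IsZeroL-resp-≋ (≋L-sym (e ∷ f)) z)
    ≋L-trans (e ∷ f) (e′ ∷ f′) = ≋-trans e e′ ∷ ≋L-trans f f′

  mutual
    ⊕-identityˡ : ∀ {n} (a b : Poly n) → IsZero a → a ⊕ b ≋ b
    ⊕-identityˡ (con x)  (con y)  z = con≈ (≈-trans (+-cong (IsZero-con⁻ z) ≈-refl) (+-identityˡ y))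
    ⊕-identityˡ (poly p) (poly q) z = poly≋ (⊕L-identityˡ p q z)

    ⊕L-identityˡ : ∀ {n} (p q : List (Poly n)) → IsZeroL p → p ⊕L q ≋L q
    ⊕L-identityˡ []      q       _ = ≋L-refl
    ⊕L-identityˡ (a ∷ p) []      z = ≋[] z
    ⊕L-identityˡ (a ∷ p) (b ∷ q) z = ⊕-identityˡ a b (∧-elimˡ z) ∷ ⊕L-identityˡ p q (∧-elimʳ z)

  mutual
    ⊕-identityʳ : ∀ {n} (a b : Poly n) → IsZero b → a ⊕ b ≋ a
    ⊕-identityʳ (con x)  (con y)  z = con≈ (≈-trans (+-cong ≈-refl (IsZero-con⁻ z)) (+-identityʳ x))
    ⊕-identityʳ (poly p) (poly q) z = poly≋ (⊕L-identityʳ p q z)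

    ⊕L-identityʳ : ∀ {n} (p q : List (Poly n)) → IsZeroL q → p ⊕L q ≋L p
    ⊕L-identityʳ []      q       z = IsZeroL⇒≋[] z
    ⊕L-identityʳ (a ∷ p) []      _ = ≋L-refl
    ⊕L-identityʳ (a ∷ p) (b ∷ q) z = ⊕-identityʳ a b (∧-elimˡ z) ∷ ⊕L-identityʳ p q (∧-elimʳ z)

  IsZero-⊕ : ∀ {n} (a b : Poly n) → IsZero a → IsZero b → IsZero (a ⊕ b)
  IsZero-⊕ a b za = IsZero-resp-≋ (≋-sym (⊕-identityˡ a b za))

  IsZeroL-⊕L : ∀ {n} (p q : List (Poly n)) → IsZeroL p → IsZeroL q → IsZeroL (p ⊕L q)
  IsZeroL-⊕L p q zp = IsZeroL-resp-≋ (≋L-sym (⊕L-identityˡ p q zp))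

  mutual
    ⊕-cong : ∀ {n} {a a′ b b′ : Poly n} → a ≋ a′ → b ≋ b′ → a ⊕ b ≋ a′ ⊕ b′
    ⊕-cong (con≈ e)  (con≈ f)  = con≈ (+-cong e f)
    ⊕-cong (poly≋ e) (poly≋ f) = poly≋ (⊕L-cong e f)

    ⊕L-cong : ∀ {n} {p p′ q q′ : List (Poly n)} → p ≋L p′ → q ≋L q′ → p ⊕L q ≋L p′ ⊕L q′
    ⊕L-cong {p′ = p′} {q′ = q′} ([]≋ z) f = ≋L-trans f (≋L-sym (⊕L-identityˡ p′ q′ z))
    ⊕L-cong {p = p} {q = q} (≋[] z) f = ≋L-trans (⊕L-identityˡ p q z) f
    ⊕L-cong {p′ = p′} {q′ = q′} e@(_ ∷ _) ([]≋ z) = ≋L-trans e (≋L-sym (⊕L-identityʳ p′ q′ z))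
    ⊕L-cong {p = p} {q = q} e@(_ ∷ _) (≋[] z) = ≋L-trans (⊕L-identityʳ p q z) e
    ⊕L-cong (e ∷ e′) (f ∷ f′) = ⊕-cong e f ∷ ⊕L-cong e′ f′

  mutual
    ⊛-zeroˡ : ∀ {n} (a b : Poly n) → IsZero a → IsZero (a ⊛ b)
    ⊛-zeroˡ (con x)  (con y)  z = IsZero-con⁺ (≈-trans (*-cong (IsZero-con⁻ z) ≈-refl) (zeroˡ y))
    ⊛-zeroˡ (poly p) (poly q) z = ⊛L-zeroˡ p q z

    ⊛L-zeroˡ : ∀ {n} (p q : List (Poly n)) → IsZeroL p → IsZeroL (p ⊛L q)
    ⊛L-zeroˡ []      q _ = refl
    ⊛L-zeroˡ {n} (a ∷ p) q z =
      IsZeroL-⊕L (scale a q) _ (scale-zeroˡ a q (∧-elimˡ z))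
        (∧-intro (IsZero-𝟘 {n}) (⊛L-zeroˡ p q (∧-elimʳ z)))

    scale-zeroˡ : ∀ {n} (a : Poly n) (q : List (Poly n)) → IsZero a → IsZeroL (scale a q)
    scale-zeroˡ a []      _ = refl
    scale-zeroˡ a (b ∷ q) z = ∧-intro (⊛-zeroˡ a b z) (scale-zeroˡ a q z)

  mutual
    ⊛-zeroʳ : ∀ {n} (a b : Poly n) → IsZero b → IsZero (a ⊛ b)
    ⊛-zeroʳ (con x)  (con y)  z = IsZero-con⁺ (≈-trans (*-cong ≈-refl (IsZero-con⁻ z)) (zeroʳ x))
    ⊛-zeroʳ (poly p) (poly q) z = ⊛L-zeroʳ p q z

    ⊛L-zeroʳ : ∀ {n} (p q : List (Poly n)) → IsZeroL q → IsZeroL (p ⊛L q)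
    ⊛L-zeroʳ []      q _ = refl
    ⊛L-zeroʳ {n} (a ∷ p) q z =
      IsZeroL-⊕L (scale a q) _ (scale-zeroʳ a q z) (∧-intro (IsZero-𝟘 {n}) (⊛L-zeroʳ p q z))

    scale-zeroʳ : ∀ {n} (a : Poly n) (q : List (Poly n)) → IsZeroL q → IsZeroL (scale a q)
    scale-zeroʳ a []      _ = refl
    scale-zeroʳ a (b ∷ q) z = ∧-intro (⊛-zeroʳ a b (∧-elimˡ z)) (scale-zeroʳ a q (∧-elimʳ z))

  mutual
    ⊛-cong : ∀ {n} {a a′ b b′ : Poly n} → a ≋ a′ → b ≋ b′ → a ⊛ b ≋ a′ ⊛ b′
    ⊛-cong (con≈ e)  (con≈ f)  = con≈ (*-cong e f)
    ⊛-cong (poly≋ e) (poly≋ f) = poly≋ (⊛L-cong e f)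

    ⊛L-cong : ∀ {n} {p p′ q q′ : List (Poly n)} → p ≋L p′ → q ≋L q′ → p ⊛L q ≋L p′ ⊛L q′
    ⊛L-cong {p′ = p′} {q′ = q′} ([]≋ z) _ = []≋ (⊛L-zeroˡ p′ q′ z)
    ⊛L-cong {p = p} {q = q} (≋[] z) _ = IsZeroL⇒≋[] (⊛L-zeroˡ p q z)
    ⊛L-cong (e ∷ e′) f = ⊕L-cong (scale-cong e f) (≋-refl ∷ ⊛L-cong e′ f)

    scale-cong : ∀ {n} {a a′ : Poly n} {q q′} → a ≋ a′ → q ≋L q′ → scale a q ≋L scale a′ q′
    scale-cong {a′ = a′} {q′ = q′} _ ([]≋ z) = []≋ (scale-zeroʳ a′ q′ z)
    scale-cong {a = a} {q = q} _ (≋[] z) = ≋[] (scale-zeroʳ a q z)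
    scale-cong e (f ∷ f′) = ⊛-cong e f ∷ scale-cong e f′

  degL-zero : ∀ {n} (p : List (Poly n)) → IsZeroL p → degL p ≡ 0
  degL-zero []       _ = refl
  degL-zero (c ∷ cs) z rewrite ∧-elimʳ {isZero c} z = refl

  degL≡0⇒tail-zero : ∀ {n} (c : Poly n) (cs : List (Poly n)) → degL (c ∷ cs) ≡ 0 → IsZeroL cs
  degL≡0⇒tail-zero c cs e with isZeroL cs
  ... | true = refl

  mutual
    degVar-zero : ∀ {n} (i : Fin n) (a : Poly n) → IsZero a → degVar i a ≡ 0
    degVar-zero fz     (poly p) z = degL-zero p z
    degVar-zero (fs i) (poly p) z = maxDeg-zero i p z

    maxDeg-zero : ∀ {n} (i : Fin n) (p : List (Poly n)) → IsZeroL p → maxDeg i p ≡ 0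
    maxDeg-zero i []      _ = refl
    maxDeg-zero i (a ∷ p) z = cong₂ _⊔_ (degVar-zero i a (∧-elimˡ z)) (maxDeg-zero i p (∧-elimʳ z))

  degL-resp-≋ : ∀ {n} {p q : List (Poly n)} → p ≋L q → degL p ≡ degL q
  degL-resp-≋ {q = q} ([]≋ z) = sym (degL-zero q z)
  degL-resp-≋ {p = p} (≋[] z) = degL-zero p z
  degL-resp-≋ (_ ∷ f) rewrite isZeroL-resp-≋ f | degL-resp-≋ f = refl

  mutual
    degVar-resp-≋ : ∀ {n} (i : Fin n) {a b : Poly n} → a ≋ b → degVar i a ≡ degVar i b
    degVar-resp-≋ fz     (poly≋ e) = degL-resp-≋ e
    degVar-resp-≋ (fs i) (poly≋ e) = maxDeg-resp-≋ i e

    maxDeg-resp-≋ : ∀ {n} (i : Fin n) {p q : List (Poly n)} → p ≋L q → maxDeg i p ≡ maxDeg i q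
    maxDeg-resp-≋ i {q = q} ([]≋ z) = sym (maxDeg-zero i q z)
    maxDeg-resp-≋ i {p = p} (≋[] z) = maxDeg-zero i p z
    maxDeg-resp-≋ i (e ∷ f) = cong₂ _⊔_ (degVar-resp-≋ i e) (maxDeg-resp-≋ i f)

  lift : ∀ {n} → Poly n → Poly (suc n)
  lift x = poly (x ∷ [])

  coeff₀ : ∀ {n} → Poly (suc n) → Poly n
  coeff₀ (poly [])       = 𝟘
  coeff₀ (poly (c ∷ cs)) = c

  FreeOfVar₀ : ∀ {n} → Poly (suc n) → Set
  FreeOfVar₀ a = degVar fz a ≡ 0

  FreeOfVar₀⇒lift : ∀ {n} (a : Poly (suc n)) → FreeOfVar₀ a → a ≋ lift (coeff₀ a)
  FreeOfVar₀⇒lift {n} (poly [])       _ = poly≋ ([]≋ (∧-intro (IsZero-𝟘 {n}) refl))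
  FreeOfVar₀⇒lift     (poly (c ∷ cs)) e = poly≋ (≋-refl ∷ IsZeroL⇒≋[] (degL≡0⇒tail-zero c cs e))

  degVar-lift : ∀ {n} (i : Fin n) (x : Poly n) → degVar (fs i) (lift x) ≡ degVar i x
  degVar-lift i x = ⊔-identityʳ (degVar i x)

  isZero-lift : ∀ {n} (x : Poly n) → isZero (lift x) ≡ isZero x
  isZero-lift x = ∧-identityʳ (isZero x)

  degVar-suc-free : ∀ {n} (a : Poly (suc n)) → FreeOfVar₀ a → ∀ i → degVar (fs i) a ≡ degVar i (coeff₀ a)
  degVar-suc-free a free i = trans (degVar-resp-≋ (fs i) (FreeOfVar₀⇒lift a free)) (degVar-lift i (coeff₀ a))

  mutual
    subst-free : ∀ {m n} (c : Poly m) (ρ : Fin m → Poly (suc n)) → (∀ k → FreeOfVar₀ (ρ k)) →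
                 subst c ρ ≋ lift (subst c (coeff₀ ∘ ρ))
    subst-free (con x)   ρ _    = ≋-refl
    subst-free (poly cs) ρ free = substL-free cs ρ free

    substL-free : ∀ {m n} (cs : List (Poly m)) (ρ : Fin (suc m) → Poly (suc n)) → (∀ k → FreeOfVar₀ (ρ k)) →
                  substL cs ρ ≋ lift (substL cs (coeff₀ ∘ ρ))
    substL-free {n = n} [] ρ free = poly≋ ([]≋ (∧-intro (IsZero-𝟘 {n}) refl))
    substL-free {n = n} (c ∷ cs) ρ free =
      ⊕-cong (subst-free c (ρ ∘ fs) (free ∘ fs))
             (≋-trans (⊛-cong (FreeOfVar₀⇒lift (ρ fz) (free fz)) (substL-free cs ρ free))
                      (poly≋ (⊕-identityʳ _ 𝟘 (IsZero-𝟘 {n}) ∷ []≋ refl)))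

  degL-∷-≤ : ∀ {n} (c : Poly n) (cs : List (Poly n)) → degL (c ∷ cs) ≤ suc (degL cs)
  degL-∷-≤ c cs with isZeroL cs
  ... | true  = z≤n
  ... | false = ≤-refl

  degL-∷-nonzero : ∀ {n} (c : Poly n) (cs : List (Poly n)) →
                   isZeroL cs ≡ false → degL (c ∷ cs) ≡ suc (degL cs)
  degL-∷-nonzero c cs eq rewrite eq = refl

  degL-∷-resp-≋ : ∀ {n} (c c′ : Poly n) {cs cs′ : List (Poly n)} →
                  cs ≋L cs′ → degL (c ∷ cs) ≡ degL (c′ ∷ cs′)
  degL-∷-resp-≋ c c′ e rewrite isZeroL-resp-≋ e | degL-resp-≋ e = refl

  degL-⊕L : ∀ {n} (p q : List (Poly n)) → degL (p ⊕L q) ≤ degL p ⊔ degL q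
  degL-⊕L []      q  = ≤-refl
  degL-⊕L (a ∷ p) [] = m≤m⊔n _ 0
  degL-⊕L (a ∷ p) (b ∷ q) with isZeroL p in zp
  ... | true =
    ≤-trans (≤-reflexive (degL-∷-resp-≋ (a ⊕ b) b (⊕L-identityˡ p q zp))) (m≤n⊔m _ _)
  ... | false with isZeroL q in zq
  ...   | true =
    ≤-trans (≤-reflexive (trans (degL-∷-resp-≋ (a ⊕ b) a (⊕L-identityʳ p q zq)) (degL-∷-nonzero a p zp)))
            (m≤m⊔n _ 0)
  ...   | false = ≤-trans (degL-∷-≤ (a ⊕ b) (p ⊕L q)) (s≤s (degL-⊕L p q))

  degL-scale : ∀ {n} (a : Poly n) (q : List (Poly n)) → degL (scale a q) ≤ degL q
  degL-scale a []      = z≤n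
  degL-scale a (b ∷ q) with isZeroL q in zq
  ... | true  rewrite scale-zeroʳ a q zq = z≤n
  ... | false = ≤-trans (degL-∷-≤ (a ⊛ b) (scale a q)) (s≤s (degL-scale a q))

  degL-⊛L : ∀ {n} (p q : List (Poly n)) → degL (p ⊛L q) ≤ degL p +ℕ degL q
  degL-⊛L     []      q = z≤n
  degL-⊛L {n} (a ∷ p) q =
    ≤-trans (degL-⊕L (scale a q) (𝟘 ∷ p ⊛L q)) (⊔-lub (≤-trans (degL-scale a q) (m≤n+m _ _)) shifted)
    where
      shifted : degL (𝟘 {n} ∷ p ⊛L q) ≤ degL (a ∷ p) +ℕ degL q
      shifted with isZeroL p in zp
      ... | true  rewrite ⊛L-zeroˡ p q zp = z≤n
      ... | false = ≤-trans (degL-∷-≤ 𝟘 (p ⊛L q)) (s≤s (degL-⊛L p q))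

  mutual
    degVar-⊕ : ∀ {n} (i : Fin n) (a b : Poly n) → degVar i (a ⊕ b) ≤ degVar i a ⊔ degVar i b
    degVar-⊕ fz     (poly p) (poly q) = degL-⊕L p q
    degVar-⊕ (fs i) (poly p) (poly q) = maxDeg-⊕L i p q

    maxDeg-⊕L : ∀ {n} (i : Fin n) (p q : List (Poly n)) → maxDeg i (p ⊕L q) ≤ maxDeg i p ⊔ maxDeg i q
    maxDeg-⊕L i []      q  = ≤-refl
    maxDeg-⊕L i (a ∷ p) [] = m≤m⊔n _ 0
    maxDeg-⊕L i (a ∷ p) (b ∷ q) = ⊔-lub
      (≤-trans (degVar-⊕ i a b) (⊔-mono-≤ (m≤m⊔n (degVar i a) _) (m≤m⊔n (degVar i b) _)))
      (≤-trans (maxDeg-⊕L i p q) (⊔-mono-≤ (m≤n⊔m (degVar i a) _) (m≤n⊔m (degVar i b) _)))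

  mutual
    degVar-⊛ : ∀ {n} (i : Fin n) (a b : Poly n) → degVar i (a ⊛ b) ≤ degVar i a +ℕ degVar i b
    degVar-⊛ fz     (poly p) (poly q) = degL-⊛L p q
    degVar-⊛ (fs i) (poly p) (poly q) = maxDeg-⊛L i p q

    maxDeg-scale : ∀ {n} (i : Fin n) (a : Poly n) (q : List (Poly n)) →
                   maxDeg i (scale a q) ≤ degVar i a +ℕ maxDeg i q
    maxDeg-scale i a []      = z≤n
    maxDeg-scale i a (b ∷ q) = ⊔-lub
      (≤-trans (degVar-⊛ i a b) (+-monoʳ-≤ (degVar i a) (m≤m⊔n (degVar i b) _)))
      (≤-trans (maxDeg-scale i a q) (+-monoʳ-≤ (degVar i a) (m≤n⊔m (degVar i b) _)))

    maxDeg-⊛L : ∀ {n} (i : Fin n) (p q : List (Poly n)) → maxDeg i (p ⊛L q) ≤ maxDeg i p +ℕ maxDeg i q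
    maxDeg-⊛L     i []      q = z≤n
    maxDeg-⊛L {n} i (a ∷ p) q = ≤-trans (maxDeg-⊕L i (scale a q) (𝟘 ∷ p ⊛L q)) (⊔-lub
      (≤-trans (maxDeg-scale i a q) (+-mono-≤ (m≤m⊔n (degVar i a) _) ≤-refl))
      (≤-trans (≤-reflexive (cong (_⊔ maxDeg i (p ⊛L q)) (degVar-zero i 𝟘 (IsZero-𝟘 {n}))))
               (≤-trans (maxDeg-⊛L i p q) (+-mono-≤ (m≤n⊔m (degVar i a) _) ≤-refl))))

  degVar-const : ∀ {n} (i : Fin n) (x : Carrier) → degVar i (const x) ≡ 0
  degVar-const fz     x = refl
  degVar-const (fs i) x = trans (⊔-identityʳ _) (degVar-const i x)

  mutual
    subst-zero : ∀ {m n} (c : Poly m) (σ : Fin m → Poly n) → IsZero c → IsZero (subst c σ)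
    subst-zero {n = n} (con x) σ z = IsZero-const {n} (IsZero-con⁻ z)
    subst-zero (poly cs) σ z = substL-zero cs σ z

    substL-zero : ∀ {m n} (cs : List (Poly m)) (σ : Fin (suc m) → Poly n) → IsZeroL cs → IsZero (substL cs σ)
    substL-zero {n = n} [] σ _ = IsZero-𝟘 {n}
    substL-zero (c ∷ cs) σ z =
      IsZero-⊕ (subst c (σ ∘ fs)) (σ fz ⊛ substL cs σ) (subst-zero c (σ ∘ fs) (∧-elimˡ z))
        (⊛-zeroʳ (σ fz) (substL cs σ) (substL-zero cs σ (∧-elimʳ z)))

  ≡0⇒≤ : ∀ {x y} → x ≡ 0 → x ≤ y
  ≡0⇒≤ refl = z≤n

  sumℕ-mono : ∀ {m} {u v : Fin m → ℕ} → (∀ k → u k ≤ v k) → sumℕ u ≤ sumℕ v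
  sumℕ-mono {zero}  _   = z≤n
  sumℕ-mono {suc m} u≤v = +-mono-≤ (u≤v fz) (sumℕ-mono (u≤v ∘ fs))

  weightedDeg : ∀ {m n} → Fin n → (Fin m → Poly n) → Poly m → ℕ
  weightedDeg i σ P = sumℕ (λ k → degVar i (σ k) *ℕ degVar k P)

  mutual
    degVar-subst : ∀ {m n} (i : Fin n) (P : Poly m) (σ : Fin m → Poly n) →
                   degVar i (subst P σ) ≤ weightedDeg i σ P
    degVar-subst i (con x)  σ = ≡0⇒≤ (degVar-const i x)
    degVar-subst i (poly p) σ = degVar-substL i p σ

    degVar-substL : ∀ {m n} (i : Fin n) (p : List (Poly m)) (σ : Fin (suc m) → Poly n) →
                    degVar i (substL p σ) ≤ weightedDeg i σ (poly p)
    degVar-substL {n = n} i [] σ = ≡0⇒≤ (degVar-zero i 𝟘 (IsZero-𝟘 {n}))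
    degVar-substL {m} i (c ∷ cs) σ =
      ≤-trans (degVar-⊕ i (subst c (σ ∘ fs)) (σ fz ⊛ substL cs σ)) (⊔-lub constTerm shiftedTerm)
      where
        open ≤-Reasoning
        e = degVar i (σ fz)

        tailWeight : List (Poly m) → ℕ
        tailWeight p = sumℕ (λ k → degVar i (σ (fs k)) *ℕ maxDeg k p)

        tailWeight-mono : ∀ {p q} → (∀ k → maxDeg k p ≤ maxDeg k q) → tailWeight p ≤ tailWeight q
        tailWeight-mono le = sumℕ-mono (λ k → *-monoʳ-≤ (degVar i (σ (fs k))) (le k))

        constTerm : degVar i (subst c (σ ∘ fs)) ≤ e *ℕ degL (c ∷ cs) +ℕ tailWeight (c ∷ cs)
        constTerm = begin
          degVar i (subst c (σ ∘ fs))  ≤⟨ degVar-subst i c (σ ∘ fs) ⟩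
          weightedDeg i (σ ∘ fs) c     ≤⟨ sumℕ-mono (λ k → *-monoʳ-≤ (degVar i (σ (fs k))) (m≤m⊔n _ _)) ⟩
          tailWeight (c ∷ cs)          ≤⟨ m≤n+m _ _ ⟩
          e *ℕ degL (c ∷ cs) +ℕ tailWeight (c ∷ cs) ∎

        shiftedTerm : degVar i (σ fz ⊛ substL cs σ) ≤ e *ℕ degL (c ∷ cs) +ℕ tailWeight (c ∷ cs)
        shiftedTerm with isZeroL cs in zcs
        ... | true = ≡0⇒≤ (degVar-zero i _ (⊛-zeroʳ (σ fz) (substL cs σ) (substL-zero cs σ zcs)))
        ... | false = begin
          degVar i (σ fz ⊛ substL cs σ)                 ≤⟨ degVar-⊛ i (σ fz) (substL cs σ) ⟩
          e +ℕ degVar i (substL cs σ)                   ≤⟨ +-monoʳ-≤ e (degVar-substL i cs σ) ⟩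
          e +ℕ (e *ℕ degL cs +ℕ tailWeight cs)          ≡⟨ sym (+-assoc e _ _) ⟩
          (e +ℕ e *ℕ degL cs) +ℕ tailWeight cs          ≡⟨ cong (_+ℕ tailWeight cs) (sym (*-suc e _)) ⟩
          e *ℕ suc (degL cs) +ℕ tailWeight cs
            ≤⟨ +-monoʳ-≤ _ (tailWeight-mono {cs} {c ∷ cs} (λ k → m≤n⊔m (degVar k c) _)) ⟩
          e *ℕ suc (degL cs) +ℕ tailWeight (c ∷ cs)     ∎

  NonZero : ∀ {n} → Poly n → Set
  NonZero a = isZero a ≡ false

  NonZeroL : ∀ {n} → List (Poly n) → Set
  NonZeroL p = isZeroL p ≡ false

  NonZero⇒¬IsZero : ∀ {n} (a : Poly n) → NonZero a → ¬ IsZero a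
  NonZero⇒¬IsZero a = not-¬

  ¬IsZero⇒NonZero : ∀ {n} (a : Poly n) → ¬ IsZero a → NonZero a
  ¬IsZero⇒NonZero a = ¬-not

  NonZero-head : ∀ {n} (c : Poly n) → isZero c ∧ true ≡ false → NonZero c
  NonZero-head c = trans (sym (∧-identityʳ (isZero c)))

  ExactDegL : ∀ {n} → List (Poly n) → ℕ → Set
  ExactDegL p d = NonZeroL p × degL p ≡ d

  ExactDeg₀ : ∀ {n} → Poly (suc n) → ℕ → Set
  ExactDeg₀ a d = NonZero a × degVar fz a ≡ d

  ExactDegL-resp-≋ : ∀ {n} {p q : List (Poly n)} {d} → p ≋L q → ExactDegL p d → ExactDegL q d
  ExactDegL-resp-≋ e (nz , deg) = trans (sym (isZeroL-resp-≋ e)) nz , trans (sym (degL-resp-≋ e)) deg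

  ExactDeg₀-resp-≋ : ∀ {n} {a b : Poly (suc n)} {d} → a ≋ b → ExactDeg₀ a d → ExactDeg₀ b d
  ExactDeg₀-resp-≋ e (nz , deg) = trans (sym (isZero-resp-≋ e)) nz , trans (sym (degVar-resp-≋ fz e)) deg

  ∷-exact : ∀ {n} (c : Poly n) (cs : List (Poly n)) {d} → ExactDegL cs d → ExactDegL (c ∷ cs) (suc d)
  ∷-exact c cs (nz , refl) = trans (cong (isZero c ∧_) nz) (∧-zeroʳ _) , degL-∷-nonzero c cs nz

  ∷-exact₀ : ∀ {n} (c : Poly n) (cs : List (Poly n)) → NonZero c → IsZeroL cs → ExactDegL (c ∷ cs) 0
  ∷-exact₀ c cs nc zcs rewrite nc | zcs = refl , refl

  ⊕L-dominated : ∀ {n} (p q : List (Poly n)) {d} → ExactDegL q d → degL p < d → ExactDegL (p ⊕L q) d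
  ⊕L-dominated []      q       exact _  = exact
  ⊕L-dominated (a ∷ p) (b ∷ q) (nq , refl) lt with isZeroL q in zq
  ... | true  = ⊥-elim (n≮0 lt)
  ... | false = ∷-exact (a ⊕ b) (p ⊕L q) tail-exact
    where
      tail-exact : ExactDegL (p ⊕L q) (degL q)
      tail-exact with isZeroL p in zp
      ... | true  = ExactDegL-resp-≋ (≋L-sym (⊕L-identityˡ p q zp)) (zq , refl)
      ... | false = ⊕L-dominated p q (zq , refl) (≤-pred lt)

  ⊕-dominated₀ : ∀ {n} (a b : Poly (suc n)) {d} → ExactDeg₀ b d → degVar fz a < d → ExactDeg₀ (a ⊕ b) d
  ⊕-dominated₀ (poly p) (poly q) = ⊕L-dominated p q

  subst-FreeOfVar₀ : ∀ {m n} (c : Poly m) (ρ : Fin m → Poly (suc n)) → (∀ k → FreeOfVar₀ (ρ k)) →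
                     FreeOfVar₀ (subst c ρ)
  subst-FreeOfVar₀ c ρ free = degVar-resp-≋ fz (subst-free c ρ free)

  substL-[c] : ∀ {m n} (c : Poly m) (σ : Fin (suc m) → Poly n) → substL (c ∷ []) σ ≋ subst c (σ ∘ fs)
  substL-[c] {n = n} c σ = ⊕-identityʳ _ _ (⊛-zeroʳ (σ fz) 𝟘 (IsZero-𝟘 {n}))

  Triangular⇒tail-free : ∀ {n} {σ : Fin (suc n) → Poly (suc n)} → Triangular R _≟_ σ →
                         ∀ k → FreeOfVar₀ (σ (fs k))
  Triangular⇒tail-free tri k = tri (fs k) fz (s≤s z≤n)

  drop₀ : ∀ {n} → (Fin (suc n) → Poly (suc n)) → Fin n → Poly n
  drop₀ σ = coeff₀ ∘ σ ∘ fs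

  Triangular-drop₀ : ∀ {n} {σ : Fin (suc n) → Poly (suc n)} → Triangular R _≟_ σ → Triangular R _≟_ (drop₀ σ)
  Triangular-drop₀ {σ = σ} tri k j j<k =
    trans (sym (degVar-suc-free (σ (fs k)) (Triangular⇒tail-free tri k) j)) (tri (fs k) (fs j) (s≤s j<k))

  Dominant⇒tail-injective : ∀ {n} {σ : Fin (suc n) → Poly (suc n)} → Dominant R _≟_ σ →
                            ∀ c → IsZero (subst c (σ ∘ fs)) → IsZero c
  Dominant⇒tail-injective {σ = σ} dom c z =
    ∧-elimˡ (dom (lift c) (IsZero-resp-≋ (≋-sym (substL-[c] c σ)) z))

  Dominant-drop₀ : ∀ {n} {σ : Fin (suc n) → Poly (suc n)} → Triangular R _≟_ σ → Dominant R _≟_ σ →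
                   Dominant R _≟_ (drop₀ σ)
  Dominant-drop₀ {σ = σ} tri dom c z =
    Dominant⇒tail-injective {σ = σ} dom c
      (IsZero-resp-≋ (≋-sym (subst-free c (σ ∘ fs) (Triangular⇒tail-free tri)))
                     (trans (isZero-lift (subst c (drop₀ σ))) z))

  module NoZeroDivisors (noZeroDivisors : ∀ {x y} → x * y ≈ 0# → x ≈ 0# ⊎ y ≈ 0#) where

    mutual
      ⊛-nonzero : ∀ {n} (a b : Poly n) → NonZero a → NonZero b → NonZero (a ⊛ b)
      ⊛-nonzero (con x) (con y) nx ny =
        dec-false ((x * y) ≟ 0#)
          ([ NonZero⇒¬IsZero (con x) nx ∘ IsZero-con⁺ , NonZero⇒¬IsZero (con y) ny ∘ IsZero-con⁺ ]′
           ∘ noZeroDivisors)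
      ⊛-nonzero (poly p) (poly q) np nq = proj₁ (⊛L-exact p q (np , refl) (nq , refl))

      scale-exact : ∀ {n} (a : Poly n) (q : List (Poly n)) {e} →
                    NonZero a → ExactDegL q e → ExactDegL (scale a q) e
      scale-exact a (b ∷ q) na (nq , refl) with isZeroL q in zq
      ... | true  = ∷-exact₀ (a ⊛ b) (scale a q) (⊛-nonzero a b na (NonZero-head b nq)) (scale-zeroʳ a q zq)
      ... | false = ∷-exact (a ⊛ b) (scale a q) (scale-exact a q na (zq , refl))

      ⊛L-exact : ∀ {n} (p q : List (Poly n)) {d e} →
                 ExactDegL p d → ExactDegL q e → ExactDegL (p ⊛L q) (d +ℕ e)
      ⊛L-exact {n} (a ∷ p) q (np , refl) (nq , refl) with isZeroL p in zp
      ... | true =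
        ExactDegL-resp-≋
          (≋L-sym (⊕L-identityʳ (scale a q) (𝟘 ∷ p ⊛L q) (∧-intro (IsZero-𝟘 {n}) (⊛L-zeroˡ p q zp))))
          (scale-exact a q (NonZero-head a np) (nq , refl))
      ... | false =
        ⊕L-dominated (scale a q) (𝟘 ∷ p ⊛L q)
          (∷-exact 𝟘 (p ⊛L q) (⊛L-exact p q (zp , refl) (nq , refl)))
          (s≤s (≤-trans (degL-scale a q) (m≤n+m (degL q) (degL p))))

    ⊛-exact₀ : ∀ {n} (a b : Poly (suc n)) {d e} → ExactDeg₀ a d → ExactDeg₀ b e → ExactDeg₀ (a ⊛ b) (d +ℕ e)
    ⊛-exact₀ (poly p) (poly q) = ⊛L-exact p q

    module _ {n} {σ : Fin (suc n) → Poly (suc n)}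
             (tail-free : ∀ k → FreeOfVar₀ (σ (fs k)))
             (tail-injective : ∀ c → IsZero (subst c (σ ∘ fs)) → IsZero c)
             {e} (deg-σ₀ : degVar fz (σ fz) ≡ suc e) where

      σ₀-exact : ExactDeg₀ (σ fz) (suc e)
      σ₀-exact =
        ¬IsZero⇒NonZero (σ fz) (λ z → 0≢1+n (trans (sym (degVar-zero fz (σ fz) z)) deg-σ₀)) , deg-σ₀

      tail-subst-free : ∀ c → FreeOfVar₀ (subst c (σ ∘ fs))
      tail-subst-free c = subst-FreeOfVar₀ c (σ ∘ fs) tail-free

      -- Horner step: c(σ₂,…) is free of x₁ while σ₁ · (rest) has positive x₁-degree,
      -- so the sum has exactly the degree of the latter.
      substL-exact : ∀ p {d} → ExactDegL p d → ExactDeg₀ (substL p σ) (d *ℕ suc e)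
      substL-exact (c ∷ cs) (np , refl) with isZeroL cs in zcs
      ... | true =
        ExactDeg₀-resp-≋
          (≋-sym (⊕-identityʳ (subst c (σ ∘ fs)) _ (⊛-zeroʳ (σ fz) (substL cs σ) (substL-zero cs σ zcs))))
          ( ¬IsZero⇒NonZero (subst c (σ ∘ fs)) (NonZero⇒¬IsZero c (NonZero-head c np) ∘ tail-injective c)
          , tail-subst-free c)
      ... | false =
        ⊕-dominated₀ (subst c (σ ∘ fs)) (σ fz ⊛ substL cs σ)
          (⊛-exact₀ (σ fz) (substL cs σ) σ₀-exact (substL-exact cs (zcs , refl)))
          (≤-trans (s≤s (≤-reflexive (tail-subst-free c))) (s≤s z≤n))

    degVar₀-subst : ∀ {n} (P : Poly (suc n)) (σ : Fin (suc n) → Poly (suc n)) →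
                    Triangular R _≟_ σ → Dominant R _≟_ σ →
                    degVar fz P *ℕ degVar fz (σ fz) ≤ degVar fz (subst P σ)
    degVar₀-subst (poly p) σ tri dom with degVar fz (σ fz) in deg-σ₀
    ... | zero  = ≡0⇒≤ (*-zeroʳ (degL p))
    ... | suc e with isZeroL p in zp
    ...   | true  = ≡0⇒≤ (cong (_*ℕ suc e) (degL-zero p zp))
    ...   | false = ≤-reflexive (sym (proj₂
      (substL-exact (Triangular⇒tail-free tri) (Dominant⇒tail-injective dom) deg-σ₀ p (zp , refl))))

    degVar-subst-lower : ∀ {n} (i : Fin n) (P : Poly n) (σ : Fin n → Poly n) →
                         (∀ j → toℕ j < toℕ i → degVar j P ≡ 0) → Triangular R _≟_ σ → Dominant R _≟_ σ →
                         degVar i P *ℕ degVar i (σ i) ≤ degVar i (subst P σ)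
    degVar-subst-lower fz     P                 σ _      tri dom = degVar₀-subst P σ tri dom
    degVar-subst-lower (fs i) (poly [])         σ _      _   _   = z≤n
    degVar-subst-lower (fs i) P@(poly (c ∷ cs)) σ P-free tri dom = begin
      degVar (fs i) P *ℕ degVar (fs i) (σ (fs i))  ≡⟨ cong₂ _*ℕ_ (degVar-suc-free P P-free₀ i)
                                                       (degVar-suc-free (σ (fs i)) (Triangular⇒tail-free tri i) i) ⟩
      degVar i c *ℕ degVar i (drop₀ σ i)          ≤⟨ degVar-subst-lower i c (drop₀ σ) c-free
                                                       (Triangular-drop₀ tri) (Dominant-drop₀ tri dom) ⟩
      degVar i (subst c (drop₀ σ))                 ≡⟨ sym (degVar-lift i _) ⟩
      degVar (fs i) (lift (subst c (drop₀ σ)))     ≡⟨ sym (degVar-resp-≋ (fs i) P∘σ≋lift) ⟩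
      degVar (fs i) (subst P σ)                    ∎
      where
        open ≤-Reasoning
        P-free₀ : FreeOfVar₀ P
        P-free₀ = P-free fz (s≤s z≤n)

        c-free : ∀ j → toℕ j < toℕ i → degVar j c ≡ 0
        c-free j j<i = trans (sym (degVar-suc-free P P-free₀ j)) (P-free (fs j) (s≤s j<i))

        P∘σ≋lift : subst P σ ≋ lift (subst c (drop₀ σ))
        P∘σ≋lift = ≋-trans
          (⊕-identityʳ _ _ (⊛-zeroʳ (σ fz) (substL cs σ) (substL-zero cs σ (degL≡0⇒tail-zero c cs P-free₀))))
          (subst-free c (σ ∘ fs) (Triangular⇒tail-free tri))

lemma7p3 : (k : CommutativeRing 0ℓ 0ℓ) (_≟_ : Decidable (CommutativeRing._≈_ k)) →
    IsNumberField k →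
    (N : ℕ) (f g : PolyMap k N) →
    Triangular k _≟_ f → DegCondition k _≟_ f → Dominant k _≟_ f →
    Triangular k _≟_ g → DegCondition k _≟_ g → Dominant k _≟_ g →
    (diag (λ i → Deg k _≟_ f i i *ℕ Deg k _≟_ g i i) ≤ₘ Deg k _≟_ (_∘ₚ_ k f g))
    × (Deg k _≟_ (_∘ₚ_ k f g) ≤ₘ (Deg k _≟_ g ·ₘ Deg k _≟_ f))
lemma7p3 k _≟_ numberField N f g f-triangular _ _ g-triangular _ g-dominant = lower , upper
  where
    open Polynomials k _≟_
    open NoZeroDivisors (numberField-noZeroDivisors k _≟_ numberField)

    lower : diag (λ i → Deg k _≟_ f i i *ℕ Deg k _≟_ g i i) ≤ₘ Deg k _≟_ (_∘ₚ_ k f g)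
    lower i j with i ≟F j
    ... | yes refl = degVar-subst-lower i (f i) g (f-triangular i) g-triangular g-dominant
    ... | no  _    = z≤n

    upper : Deg k _≟_ (_∘ₚ_ k f g) ≤ₘ (Deg k _≟_ g ·ₘ Deg k _≟_ f)
    upper i j = degVar-subst i (f j) g
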